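{- Let $G$ be an $\alpha$-weakly-Helly graph and let $H=\mathcal{H}(G)$ be its injective hull. For every integer $\ell\ge 0$ and every $M\subseteq V(G)$, $$diam_G(C_G^{\ell}(M))-2\alpha\ \le\ diam_H(C_H^{\ell}(M))\ \le\ diam_G(C_G^{\alpha+\ell}(M))+2\alpha.$$
   Context: All graphs are finite, simple, undirected, unweighted and connected. $D_G(v,r)=\{u: d_G(u,v)\le r\}$. A graph $G$ is $\alpha$-weakly-Helly if for every family of pairwise intersecting disks $\{D_G(v,r(v)) : v\in S\}$ the disks $D_G(v,r(v)+\alpha)$, $v\in S$, have a common vertex; Helly graphs are the $0$-weakly-Helly graphs. The injective hull $\mathcal{H}(G)$ is the unique minimal Helly graph containing $G$ as an isometric subgraph; $V(G)$ is identified with its image in $\mathcal{H}(G)$. For a graph $X$ containing $M$ (here $X\in\{G,H\}$) and $v\in V(X)$: $e_X^M(v)=\max_{u\in M}d_X(v,u)$, $rad_X(M)=\min_{v\in V(X)}e_X^M(v)$, $C_X^{\ell}(M)=\{v\in V(X): e_X^M(v)\le rad_X(M)+\ell\}$. For $S\subseteq V(X)$, $diam_X(S)=\max_{u,v\in S}d_X(u,v)$. -}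

module Defs where

open import Data.Nat using (ℕ; zero; suc; _+_; _*_; _≤_; _⊔_; _⊓_; _≤ᵇ_)
open import Data.Fin using (Fin; zero; suc)
open import Data.Bool using (Bool; true; false; if_then_else_; _∧_; _∨_)
open import Data.Product using (∃; _,_)
open import Data.Product.Base using (_×_)
open import Relation.Binary.PropositionalEquality using (_≡_)
open import Function using (_∘_)

-- Maximum / minimum of a ℕ-valued function over Fin n.
-- maxF over the empty index set is 0; minF over the empty set is 0
-- (never used on an empty set: every graph considered has a vertex).
maxF : ∀ {n} → (Fin n → ℕ) → ℕ
maxF {zero} f = 0
maxF {suc n} f = f zero ⊔ maxF (f ∘ suc)

minF : ∀ {n} → (Fin n → ℕ) → ℕ
minF {zero} f = 0
minF {suc zero} f = f zero
minF {suc (suc n)} f = f zero ⊓ minF (f ∘ suc)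

anyF : ∀ {n} → (Fin n → Bool) → Bool
anyF {zero} f = false
anyF {suc n} f = f zero ∨ anyF (f ∘ suc)

_==_ : ∀ {n} → Fin n → Fin n → Bool
zero == zero = true
zero == suc _ = false
suc _ == zero = false
suc i == suc j = i == j

-- least k < b with p k, or b if there is none
firstTrue : ℕ → (ℕ → Bool) → ℕ
firstTrue zero p = zero
firstTrue (suc b) p = if p 0 then 0 else suc (firstTrue b (λ k → p (suc k)))

within : ∀ {n} → (Fin n → Fin n → Bool) → ℕ → Fin n → Fin n → Bool
within adj zero u v = u == v
within adj (suc k) u v = within adj k u v ∨ anyF (λ w → within adj k u w ∧ adj w v)

record Graph : Set where
  field
    n         : ℕ
    adj       : Fin n → Fin n → Bool
    adj-sym   : ∀ u v → adj u v ≡ adj v u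
    adj-irr   : ∀ u → adj u u ≡ false
    connected : ∀ u v → ∃ λ k → within adj k u v ≡ true

open Graph public

V : Graph → Set
V G = Fin (n G)

-- shortest-path distance d_G(u,v) (a shortest path has length < n)
dist : (G : Graph) → V G → V G → ℕ
dist G u v = firstTrue (n G) (λ k → within (adj G) k u v)

WeaklyHelly : ℕ → Graph → Set
WeaklyHelly α G =
  (S : V G → Bool) (r : V G → ℕ) →
  (∀ u v → S u ≡ true → S v ≡ true →
     ∃ λ x → dist G u x ≤ r u × dist G v x ≤ r v) →
  ∃ λ x → ∀ v → S v ≡ true → dist G v x ≤ r v + α

Helly : Graph → Set
Helly G = WeaklyHelly 0 G

IsometricEmbedding : (G H : Graph) → (V G → V H) → Set
IsometricEmbedding G H φ = ∀ u v → dist H (φ u) (φ v) ≡ dist G u v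

record IsInjectiveHull (G H : Graph) (φ : V G → V H) : Set₁ where
  field
    helly     : Helly H
    isometric : IsometricEmbedding G H φ
    minimal   : (H' : Graph) (ψ : V H' → V H) → Helly H' →
                IsometricEmbedding H' H ψ →
                (∀ u → ∃ λ w → ψ w ≡ φ u) → ∀ x → ∃ λ w → ψ w ≡ x

-- Eccentricity, radius, centers and diameter, for a set M ⊆ V(G)
-- (given by its characteristic function) seen inside X via f : V G → V X.

ecc : (G X : Graph) → (V G → V X) → (V G → Bool) → V X → ℕ
ecc G X f M v = maxF (λ u → if M u then dist X v (f u) else 0)

rad : (G X : Graph) → (V G → V X) → (V G → Bool) → ℕ
rad G X f M = minF (λ v → ecc G X f M v)

center : (G X : Graph) → (V G → V X) → (V G → Bool) → ℕ → V X → Bool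
center G X f M ℓ v = ecc G X f M v ≤ᵇ rad G X f M + ℓ

diam : (X : Graph) → (V X → Bool) → ℕ
diam X S = maxF (λ u → maxF (λ v → if S u ∧ S v then dist X u v else 0))

module Submission where

-- The argument has three layers.
--   1. Distances.  `dist` is the least walk length; we show it is a metric in
--      which every distance is realised by a walk (long walks shorten below n
--      by a counting argument), so disks meet iff their radii sum to at least
--      the distance of their centres, and (weak) Helly properties can be used
--      with a purely metric hypothesis.
--   2. The hull is close to G.  A vertex z of a Helly graph dominated by some
--      h₁ ≠ z can be deleted: the rest is a Helly isometric subgraph (it is a
--      retract).  By minimality of the hull, such z lies in φ(V G).  A descent
--      argument then puts every h ∈ H on a geodesic between two vertices of G,
--      and together with the α-weak Helly property of G this puts every vertex
--      of H within distance α of φ(V G).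
--   3. Centres.  Hence rad_H(M) ≤ rad_G(M) ≤ rad_H(M) + α; every vertex of
--      C_H^ℓ(M) is within α of a vertex of C_G^{α+ℓ}(M), and (by one Helly
--      argument in H) every vertex of C_G^ℓ(M) is within α of a vertex of
--      C_H^ℓ(M).  Both diameter bounds follow by the triangle inequality.

open import Defs
open import Data.Nat using (ℕ; zero; suc; _+_; _*_; _≤_; _<_; _⊔_; _⊓_; _≤?_; _∸_; z≤n; s≤s; pred; >-nonZero)
open import Data.Nat.Properties hiding (_≟_)
open import Data.Fin using (Fin; zero; suc; punchIn; punchOut; _≟_)
open import Data.Fin.Properties using (punchIn-injective; punchInᵢ≢i; punchIn-punchOut; any?)
open import Data.Bool using (Bool; true; false; if_then_else_; _∧_; _∨_)
open import Data.Bool.Properties using (T-≡)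
open import Data.Product using (∃; _×_; _,_; proj₁; proj₂)
open import Data.Sum using (_⊎_; inj₁; inj₂)
open import Data.Empty using (⊥; ⊥-elim)
open import Relation.Nullary using (Dec; yes; no)
open import Relation.Nullary.Decidable using (_×-dec_; ¬?)
open import Relation.Binary.PropositionalEquality
  using (_≡_; _≢_; refl; sym; trans; cong; cong₂; subst; subst₂)
open import Function using (_∘_; id; Equivalence)

∨-elim : ∀ {a b} → a ∨ b ≡ true → a ≡ true ⊎ b ≡ true
∨-elim {true} _ = inj₁ refl
∨-elim {false} p = inj₂ p

∨-introˡ : ∀ {a b} → a ≡ true → a ∨ b ≡ true
∨-introˡ refl = refl

∨-introʳ : ∀ a {b} → b ≡ true → a ∨ b ≡ true
∨-introʳ true _ = refl
∨-introʳ false p = p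

∧-elim : ∀ {a b} → a ∧ b ≡ true → a ≡ true × b ≡ true
∧-elim {true} p = refl , p
∧-elim {false} ()

∧-intro : ∀ {a b} → a ≡ true → b ≡ true → a ∧ b ≡ true
∧-intro refl p = p

bool-ext : ∀ {a b} → (a ≡ true → b ≡ true) → (b ≡ true → a ≡ true) → a ≡ b
bool-ext {true} a⇒b _ = sym (a⇒b refl)
bool-ext {false} {true} _ b⇒a = b⇒a refl
bool-ext {false} {false} _ _ = refl

==-refl : ∀ {n} (i : Fin n) → (i == i) ≡ true
==-refl zero = refl
==-refl (suc i) = ==-refl i

==-sound : ∀ {n} {i j : Fin n} → (i == j) ≡ true → i ≡ j
==-sound {i = zero} {zero} _ = refl
==-sound {i = suc i} {suc j} p = cong suc (==-sound p)

anyF-intro : ∀ {n} (f : Fin n → Bool) i → f i ≡ true → anyF f ≡ true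
anyF-intro f zero p = ∨-introˡ p
anyF-intro f (suc i) p = ∨-introʳ (f zero) (anyF-intro (f ∘ suc) i p)

anyF-elim : ∀ {n} (f : Fin n → Bool) → anyF f ≡ true → ∃ λ i → f i ≡ true
anyF-elim {suc n} f p with ∨-elim {f zero} p
... | inj₁ q = zero , q
... | inj₂ q with anyF-elim (f ∘ suc) q
... | i , r = suc i , r

anyF-cong : ∀ {n} (f g : Fin n → Bool) → (∀ i → f i ≡ g i) → anyF f ≡ anyF g
anyF-cong {zero} f g e = refl
anyF-cong {suc n} f g e = cong₂ _∨_ (e zero) (anyF-cong (f ∘ suc) (g ∘ suc) (e ∘ suc))

maxF-ub : ∀ {n} (f : Fin n → ℕ) i → f i ≤ maxF f
maxF-ub f zero = m≤m⊔n _ _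
maxF-ub f (suc i) = ≤-trans (maxF-ub (f ∘ suc) i) (m≤n⊔m _ _)

maxF-lub : ∀ {n} (f : Fin n → ℕ) K → (∀ i → f i ≤ K) → maxF f ≤ K
maxF-lub {zero} f K h = z≤n
maxF-lub {suc n} f K h = ⊔-lub (h zero) (maxF-lub (f ∘ suc) K (h ∘ suc))

maxF-cong : ∀ {n} (f g : Fin n → ℕ) → (∀ i → f i ≡ g i) → maxF f ≡ maxF g
maxF-cong {zero} f g e = refl
maxF-cong {suc n} f g e = cong₂ _⊔_ (e zero) (maxF-cong (f ∘ suc) (g ∘ suc) (e ∘ suc))

minF-lb : ∀ {n} (f : Fin n → ℕ) i → minF f ≤ f i
minF-lb {suc zero} f zero = ≤-refl
minF-lb {suc (suc n)} f zero = m⊓n≤m _ _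
minF-lb {suc (suc n)} f (suc i) = ≤-trans (m⊓n≤n _ _) (minF-lb (f ∘ suc) i)

minF-attained⁺ : ∀ {n} (f : Fin (suc n) → ℕ) → ∃ λ i → minF f ≡ f i
minF-attained⁺ {zero} f = zero , refl
minF-attained⁺ {suc n} f with ⊓-sel (f zero) (minF (f ∘ suc))
... | inj₁ e = zero , e
... | inj₂ e with minF-attained⁺ (f ∘ suc)
... | i , q = suc i , trans e q

minF-attained : ∀ {n} (f : Fin n → ℕ) → Fin n → ∃ λ i → minF f ≡ f i
minF-attained {suc n} f _ = minF-attained⁺ f

image : ∀ {k m} → (Fin k → Bool) → (Fin k → Fin m) → Fin m → Bool
image P f y = anyF (λ i → P i ∧ (f i == y))

image-intro : ∀ {k m} (P : Fin k → Bool) (f : Fin k → Fin m) i → P i ≡ true → image P f (f i) ≡ true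
image-intro P f i Pi = anyF-intro (λ j → P j ∧ (f j == f i)) i (∧-intro Pi (==-refl (f i)))

image-elim : ∀ {k m} (P : Fin k → Bool) (f : Fin k → Fin m) y →
             image P f y ≡ true → ∃ λ i → P i ≡ true × f i ≡ y
image-elim P f y p with anyF-elim _ p
... | i , q with ∧-elim {P i} q
... | Pi , fi=y = i , Pi , ==-sound fi=y

image-all : ∀ {k m} (P : Fin k → Bool) (f : Fin k → Fin m) (Q : Fin m → Set) →
            (∀ i → P i ≡ true → Q (f i)) → ∀ y → image P f y ≡ true → Q y
image-all P f Q all-Q y p with image-elim P f y p
... | i , Pi , refl = all-Q i Pi

firstTrue-least : ∀ b (p : ℕ → Bool) k → p k ≡ true → firstTrue b p ≤ k
firstTrue-least zero p k _ = z≤n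
firstTrue-least (suc b) p k pk with p 0 in e
... | true = z≤n
firstTrue-least (suc b) p zero pk | false with trans (sym e) pk
... | ()
firstTrue-least (suc b) p (suc k) pk | false = s≤s (firstTrue-least b (p ∘ suc) k pk)

firstTrue-sound : ∀ b (p : ℕ → Bool) k → k < b → p k ≡ true → p (firstTrue b p) ≡ true
firstTrue-sound (suc b) p k k<b pk with p 0 in e
... | true = e
firstTrue-sound (suc b) p zero k<b pk | false with trans (sym e) pk
... | ()
firstTrue-sound (suc b) p (suc k) (s≤s k<b) pk | false = firstTrue-sound b (p ∘ suc) k k<b pk

firstTrue-≤ : ∀ b p → firstTrue b p ≤ b
firstTrue-≤ zero p = z≤n
firstTrue-≤ (suc b) p with p 0
... | true = z≤n
... | false = s≤s (firstTrue-≤ b (p ∘ suc))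

-- Cardinality of subsets of Fin n; used to bound the length of shortest walks.

count : ∀ {n} → (Fin n → Bool) → ℕ
count {zero} f = 0
count {suc n} f = (if f zero then 1 else 0) + count (f ∘ suc)

count-≤ : ∀ {n} (f : Fin n → Bool) → count f ≤ n
count-≤ {zero} f = z≤n
count-≤ {suc n} f with f zero
... | true = s≤s (count-≤ (f ∘ suc))
... | false = m≤n⇒m≤1+n (count-≤ (f ∘ suc))

count-proper : ∀ {n} (f : Fin n → Bool) i → f i ≡ false → count f < n
count-proper {suc n} f zero e rewrite e = s≤s (count-≤ (f ∘ suc))
count-proper {suc n} f (suc i) e with f zero
... | true = s≤s (count-proper (f ∘ suc) i e)
... | false = m≤n⇒m≤1+n (count-proper (f ∘ suc) i e)

count-mono : ∀ {n} (f g : Fin n → Bool) → (∀ v → f v ≡ true → g v ≡ true) → count f ≤ count g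
count-mono {zero} f g f⊆g = z≤n
count-mono {suc n} f g f⊆g with f zero in ef | g zero in eg
... | true | true = s≤s (count-mono (f ∘ suc) (g ∘ suc) (f⊆g ∘ suc))
... | false | true = m≤n⇒m≤1+n (count-mono (f ∘ suc) (g ∘ suc) (f⊆g ∘ suc))
... | false | false = count-mono (f ∘ suc) (g ∘ suc) (f⊆g ∘ suc)
... | true | false with trans (sym eg) (f⊆g zero ef)
... | ()

count-strict : ∀ {n} (f g : Fin n → Bool) → (∀ v → f v ≡ true → g v ≡ true) →
               ∀ i → g i ≡ true → f i ≡ false → count f < count g
count-strict {suc n} f g f⊆g zero gi fi rewrite gi | fi = s≤s (count-mono (f ∘ suc) (g ∘ suc) (f⊆g ∘ suc))
count-strict {suc n} f g f⊆g (suc i) gi fi with f zero in ef | g zero in eg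
... | true | true = s≤s (count-strict (f ∘ suc) (g ∘ suc) (f⊆g ∘ suc) i gi fi)
... | false | true = m≤n⇒m≤1+n (count-strict (f ∘ suc) (g ∘ suc) (f⊆g ∘ suc) i gi fi)
... | false | false = count-strict (f ∘ suc) (g ∘ suc) (f⊆g ∘ suc) i gi fi
... | true | false with trans (sym eg) (f⊆g zero ef)
... | ()

count-pos : ∀ {n} (f : Fin n → Bool) i → f i ≡ true → 1 ≤ count f
count-pos f zero e rewrite e = s≤s z≤n
count-pos f (suc i) e with f zero
... | true = s≤s z≤n
... | false = count-pos (f ∘ suc) i e

⊆-or-witness : ∀ {n} (f g : Fin n → Bool) →
  (∀ v → f v ≡ true → g v ≡ true) ⊎ ∃ λ v → f v ≡ true × g v ≡ false
⊆-or-witness {zero} f g = inj₁ λ ()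
⊆-or-witness {suc n} f g with f zero in ef | g zero in eg | ⊆-or-witness (f ∘ suc) (g ∘ suc)
... | true | false | _ = inj₂ (zero , ef , eg)
... | _ | _ | inj₂ (v , p , q) = inj₂ (suc v , p , q)
... | true | true | inj₁ f⊆g = inj₁ λ { zero _ → eg ; (suc v) → f⊆g v }
... | false | _ | inj₁ f⊆g = inj₁ λ { zero p → ⊥-elim (false≢true (trans (sym ef) p)) ; (suc v) → f⊆g v }
  where
  false≢true : false ≡ true → ⊥
  false≢true ()

module Walks {N : ℕ} (A : Fin N → Fin N → Bool) where

  within-suc : ∀ k u v → within A k u v ≡ true → within A (suc k) u v ≡ true
  within-suc k u v = ∨-introˡ

  within-mono : ∀ {k k'} u v → k ≤ k' → within A k u v ≡ true → within A k' u v ≡ true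
  within-mono {k' = k'} u v z≤n p = lift k' p
    where
    lift : ∀ j → within A 0 u v ≡ true → within A j u v ≡ true
    lift zero p = p
    lift (suc j) p = within-suc j u v (lift j p)
  within-mono {suc k} {suc k'} u v (s≤s k≤k') p with ∨-elim {within A k u v} p
  ... | inj₁ q = within-suc k' u v (within-mono u v k≤k' q)
  ... | inj₂ q with anyF-elim _ q
  ... | w , r with ∧-elim {within A k u w} r
  ... | uw , wv = ∨-introʳ (within A k' u v)
                    (anyF-intro (λ x → within A k' u x ∧ A x v) w (∧-intro (within-mono u w k≤k' uw) wv))

  within-edge : ∀ u v → A u v ≡ true → within A 1 u v ≡ true
  within-edge u v e = ∨-introʳ (u == v) (anyF-intro (λ y → (u == y) ∧ A y v) u (∧-intro (==-refl u) e))

  within-one : ∀ u v → within A 1 u v ≡ true → u ≡ v ⊎ A u v ≡ true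
  within-one u v p with ∨-elim {u == v} p
  ... | inj₁ q = inj₁ (==-sound q)
  ... | inj₂ q with anyF-elim _ q
  ... | x , r with ∧-elim {u == x} r
  ... | ux , xv with ==-sound {i = u} ux
  ... | refl = inj₂ xv

  within-concat : ∀ a b u v w → within A a u v ≡ true → within A b v w ≡ true → within A (b + a) u w ≡ true
  within-concat a zero u v w p q with ==-sound {i = v} q
  ... | refl = p
  within-concat a (suc b) u v w p q with ∨-elim {within A b v w} q
  ... | inj₁ q' = within-suc (b + a) u w (within-concat a b u v w p q')
  ... | inj₂ q' with anyF-elim _ q'
  ... | x , r with ∧-elim {within A b v x} r
  ... | vx , xw = ∨-introʳ (within A (b + a) u w)
                    (anyF-intro (λ y → within A (b + a) u y ∧ A y w) x (∧-intro (within-concat a b u v x p vx) xw))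

  within-split : ∀ a b u v → within A (b + a) u v ≡ true →
                 ∃ λ w → within A a u w ≡ true × within A b w v ≡ true
  within-split a zero u v p = v , p , ==-refl v
  within-split a (suc b) u v p with ∨-elim {within A (b + a) u v} p
  ... | inj₁ q with within-split a b u v q
  ... | w , uw , wv = w , uw , within-suc b w v wv
  within-split a (suc b) u v p | inj₂ q with anyF-elim _ q
  ... | x , r with ∧-elim {within A (b + a) u x} r
  ... | ux , xv with within-split a b u x ux
  ... | w , uw , wx = w , uw , ∨-introʳ (within A b w v)
                                 (anyF-intro (λ y → within A b w y ∧ A y v) x (∧-intro wx xv))

  within-sym : (∀ u v → A u v ≡ A v u) → ∀ k u v → within A k u v ≡ true → within A k v u ≡ true
  within-sym A-sym zero u v p with ==-sound {i = u} p
  ... | refl = ==-refl u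
  within-sym A-sym (suc k) u v p with ∨-elim {within A k u v} p
  ... | inj₁ q = within-suc k v u (within-sym A-sym k u v q)
  ... | inj₂ q with anyF-elim _ q
  ... | x , r with ∧-elim {within A k u x} r
  ... | ux , xv = subst (λ t → within A t v u ≡ true) (+-comm k 1)
                    (within-concat 1 k v x u (within-edge v x (trans (A-sym v x) xv)) (within-sym A-sym k u x ux))

  ball-stable : ∀ u j → (∀ v → within A (suc j) u v ≡ within A j u v) →
                ∀ m v → within A (m + j) u v ≡ within A j u v
  ball-stable u j st zero v = refl
  ball-stable u j st (suc m) v =
    trans (cong₂ _∨_ (ball-stable u j st m v)
                     (anyF-cong _ _ (λ w → cong (λ b → b ∧ A w v) (ball-stable u j st m w))))
          (st v)

  ball-grows : ∀ u k → (∃ λ j → j ≤ k × (∀ v → within A (suc j) u v ≡ within A j u v))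
                       ⊎ (k < count (within A k u))
  ball-grows u zero = inj₂ (count-pos (within A 0 u) u (==-refl u))
  ball-grows u (suc k) with ball-grows u k
  ... | inj₁ (j , j≤k , st) = inj₁ (j , m≤n⇒m≤1+n j≤k , st)
  ... | inj₂ big with ⊆-or-witness (within A (suc k) u) (within A k u)
  ... | inj₁ same = inj₁ (k , n≤1+n k , λ v → bool-ext (same v) (within-suc k u v))
  ... | inj₂ (v , new , old) =
        inj₂ (≤-trans (s≤s big) (count-strict (within A k u) (within A (suc k) u) (within-suc k u) v new old))

walk-shorten : ∀ {N'} (A : Fin (suc N') → Fin (suc N') → Bool) u v k →
               within A k u v ≡ true → within A N' u v ≡ true
walk-shorten {N'} A u v k p with Walks.ball-grows A u N'
... | inj₁ (j , j≤N' , st) = Walks.within-mono A u v j≤N' within-j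
  where
  within-j : within A j u v ≡ true
  within-j with ≤-total k j
  ... | inj₁ k≤j = Walks.within-mono A u v k≤j p
  ... | inj₂ j≤k = trans (sym (Walks.ball-stable A u j st (k ∸ j) v))
                         (subst (λ t → within A t u v ≡ true) (sym (m∸n+n≡m j≤k)) p)
... | inj₂ big with within A N' u v in e
... | true = refl
... | false = ⊥-elim (<⇒≱ (count-proper (within A N' u) v e) big)

WeakHom : ∀ {N N'} → (Fin N → Fin N → Bool) → (Fin N' → Fin N' → Bool) → (Fin N → Fin N') → Set
WeakHom A A' f = ∀ a b → A a b ≡ true → f a ≡ f b ⊎ A' (f a) (f b) ≡ true

walk-map : ∀ {N N'} (A : Fin N → Fin N → Bool) (A' : Fin N' → Fin N' → Bool) (f : Fin N → Fin N') →
           WeakHom A A' f → ∀ k a b → within A k a b ≡ true → within A' k (f a) (f b) ≡ true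
walk-map A A' f hom zero a b p with ==-sound {i = a} p
... | refl = ==-refl (f a)
walk-map A A' f hom (suc k) a b p with ∨-elim {within A k a b} p
... | inj₁ q = Walks.within-suc A' k (f a) (f b) (walk-map A A' f hom k a b q)
... | inj₂ q with anyF-elim _ q
... | x , r with ∧-elim {within A k a x} r
... | ax , xb with hom x b xb
... | inj₁ fx≡fb = Walks.within-suc A' k (f a) (f b)
                     (subst (λ y → within A' k (f a) y ≡ true) fx≡fb (walk-map A A' f hom k a x ax))
... | inj₂ edge = Walks.within-concat A' k 1 (f a) (f x) (f b) (walk-map A A' f hom k a x ax)
                    (Walks.within-edge A' (f x) (f b) edge)

module Metric (X : Graph) where
  private
    d : V X → V X → ℕ
    d = dist X
    A : Fin (n X) → Fin (n X) → Bool
    A = adj X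

  dist-≤ : ∀ {k} u v → within A k u v ≡ true → d u v ≤ k
  dist-≤ {k} u v p = firstTrue-least (n X) (λ j → within A j u v) k p

  dist-walk : ∀ u v → within A (d u v) u v ≡ true
  dist-walk u v = realise (n X) A u v (connected X u v)
    where
    realise : ∀ N (B : Fin N → Fin N → Bool) a b → (∃ λ k → within B k a b ≡ true) →
              within B (firstTrue N (λ j → within B j a b)) a b ≡ true
    realise (suc N') B a b (k , p) = firstTrue-sound (suc N') (λ j → within B j a b) N' ≤-refl (walk-shorten B a b k p)

  dist-bounded : ∀ u v → d u v ≤ n X
  dist-bounded u v = firstTrue-≤ (n X) _

  dist-triangle : ∀ u v w → d u w ≤ d u v + d v w
  dist-triangle u v w = subst (d u w ≤_) (+-comm (d v w) (d u v))
    (dist-≤ u w (Walks.within-concat A (d u v) (d v w) u v w (dist-walk u v) (dist-walk v w)))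

  dist-sym : ∀ u v → d u v ≡ d v u
  dist-sym u v = ≤-antisym (flip u v) (flip v u)
    where
    flip : ∀ a b → d a b ≤ d b a
    flip a b = dist-≤ a b (Walks.within-sym A (adj-sym X) (d b a) b a (dist-walk b a))

  dist-refl : ∀ u → d u u ≡ 0
  dist-refl u = n≤0⇒n≡0 (dist-≤ {0} u u (==-refl u))

  dist-zero : ∀ u v → d u v ≡ 0 → u ≡ v
  dist-zero u v e = ==-sound (subst (λ t → within A t u v ≡ true) e (dist-walk u v))

  dist-pos : ∀ {u v} → u ≢ v → 1 ≤ d u v
  dist-pos {u} {v} u≢v = n≢0⇒n>0 (u≢v ∘ dist-zero u v)

  dist-split : ∀ u v a b → d u v ≤ a + b → ∃ λ w → d u w ≤ a × d w v ≤ b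
  dist-split u v a b le
    with Walks.within-split A a b u v (Walks.within-mono A u v (subst (d u v ≤_) (+-comm a b) le) (dist-walk u v))
  ... | w , uw , wv = w , dist-≤ u w uw , dist-≤ w v wv

  dist-adj : ∀ u v → adj X u v ≡ true → d u v ≤ 1
  dist-adj u v e = dist-≤ u v (Walks.within-edge A u v e)

  dist-one : ∀ u v → d u v ≤ 1 → u ≡ v ⊎ adj X u v ≡ true
  dist-one u v le = Walks.within-one A u v (Walks.within-mono A u v le (dist-walk u v))

  dist-detour : ∀ {a a' b b' c} → d a a' ≤ c → d b b' ≤ c → d a b ≤ d a' b' + 2 * c
  dist-detour {a} {a'} {b} {b'} {c} aa' bb' = begin
    d a b                  ≤⟨ dist-triangle a a' b ⟩
    d a a' + d a' b        ≤⟨ +-mono-≤ aa' (dist-triangle a' b' b) ⟩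
    c + (d a' b' + d b' b) ≤⟨ +-monoʳ-≤ c (+-monoʳ-≤ (d a' b') (subst (_≤ c) (dist-sym b b') bb')) ⟩
    c + (d a' b' + c)      ≡⟨ +-comm c (d a' b' + c) ⟩
    (d a' b' + c) + c      ≡⟨ +-assoc (d a' b') c c ⟩
    d a' b' + (c + c)      ≡⟨ cong (λ t → d a' b' + (c + t)) (sym (+-identityʳ c)) ⟩
    d a' b' + 2 * c        ∎
    where open ≤-Reasoning

dist-nonexpanding : (X Y : Graph) (f : V X → V Y) → WeakHom (adj X) (adj Y) f →
                    ∀ a b → dist Y (f a) (f b) ≤ dist X a b
dist-nonexpanding X Y f hom a b =
  Metric.dist-≤ Y (f a) (f b) (walk-map (adj X) (adj Y) f hom (dist X a b) a b (Metric.dist-walk X a b))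

-- Weak Helly property with a metric hypothesis: since disks meet iff their radii
-- cover the distance of their centres, it suffices that d(u,v) ≤ r u + r v.
weaklyHelly-dist : ∀ {α} (X : Graph) → WeaklyHelly α X → (S : V X → Bool) (r : V X → ℕ) →
  (∀ u v → S u ≡ true → S v ≡ true → dist X u v ≤ r u + r v) →
  ∃ λ x → ∀ v → S v ≡ true → dist X v x ≤ r v + α
weaklyHelly-dist X wh S r bound = wh S r meet
  where
  meet : ∀ u v → S u ≡ true → S v ≡ true → ∃ λ x → dist X u x ≤ r u × dist X v x ≤ r v
  meet u v su sv with Metric.dist-split X u v (r u) (r v) (bound u v su sv)
  ... | w , uw , wv = w , uw , subst (_≤ r v) (Metric.dist-sym X w v) wv

helly-dist : (X : Graph) → Helly X → (S : V X → Bool) (r : V X → ℕ) →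
  (∀ u v → S u ≡ true → S v ≡ true → dist X u v ≤ r u + r v) →
  ∃ λ x → ∀ v → S v ≡ true → dist X v x ≤ r v
helly-dist X h S r bound with weaklyHelly-dist X h S r bound
... | x , near = x , λ v sv → subst (dist X v x ≤_) (+-identityʳ (r v)) (near v sv)

helly-anchor : (X : Graph) → Helly X → (T : V X → Bool) (t : V X) (a b : ℕ) → a ≤ b →
  (∀ v → T v ≡ true → dist X t v ≤ a + b) →
  (∀ u v → T u ≡ true → T v ≡ true → dist X u v ≤ b + b) →
  ∃ λ x → dist X t x ≤ a × ∀ v → T v ≡ true → dist X v x ≤ b
helly-anchor X h T t a b a≤b t-close T-close = x , t-near , T-near
  where
  open Metric X
  radius : Bool → ℕ
  radius true = a
  radius false = b
  radius≤b : ∀ c → radius c ≤ b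
  radius≤b true = a≤b
  radius≤b false = ≤-refl
  S : V X → Bool
  S v = (v == t) ∨ T v
  -- in the branches where u ≠ t (resp. v ≠ t) the hypothesis on u (resp. v) reduces to T u ≡ true
  bound : ∀ u v → S u ≡ true → S v ≡ true → dist X u v ≤ radius (u == t) + radius (v == t)
  bound u v su sv with u == t in eu | v == t in ev
  ... | true | true =
        subst (_≤ a + a) (sym (trans (cong₂ (dist X) (==-sound eu) (==-sound ev)) (dist-refl t))) z≤n
  ... | true | false = subst (λ w → dist X w v ≤ a + b) (sym (==-sound eu)) (t-close v sv)
  ... | false | true = subst₂ _≤_ (trans (dist-sym t u) (cong (dist X u) (sym (==-sound ev)))) (+-comm a b)
                               (t-close u su)
  ... | false | false = T-close u v su sv
  centre : ∃ λ y → ∀ v → S v ≡ true → dist X v y ≤ radius (v == t)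
  centre = helly-dist X h S (λ v → radius (v == t)) bound
  x : V X
  x = proj₁ centre
  t-near : dist X t x ≤ a
  t-near = subst (λ c → dist X t x ≤ radius c) (==-refl t) (proj₂ centre t (∨-introˡ (==-refl t)))
  T-near : ∀ v → T v ≡ true → dist X v x ≤ b
  T-near v Tv = ≤-trans (proj₂ centre v (∨-introʳ (v == t) Tv)) (radius≤b (v == t))

-- A retract of a Helly graph is Helly: if ψ embeds H' isometrically into H and the
-- nonexpanding map ρ satisfies ρ ∘ ψ = id, a Helly family of H' is solved in H
-- and the solution is projected back by ρ.
retract-helly : (H H' : Graph) (ψ : V H' → V H) (ρ : V H → V H') →
  IsometricEmbedding H' H ψ → (∀ i → ρ (ψ i) ≡ i) →
  (∀ a b → dist H' (ρ a) (ρ b) ≤ dist H a b) → Helly H → Helly H'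
retract-helly H H' ψ ρ ψ-iso ρψ ρ-nonexp helly-H S' R' meet' = ρ x , near
  where
  S : V H → Bool
  S = image S' ψ
  R : V H → ℕ
  R v = R' (ρ v)
  R-ψ : ∀ i → R (ψ i) ≡ R' i
  R-ψ i = cong R' (ρψ i)
  meet : ∀ u v → S u ≡ true → S v ≡ true → ∃ λ y → dist H u y ≤ R u × dist H v y ≤ R v
  meet u v su sv with image-elim S' ψ u su | image-elim S' ψ v sv
  ... | i , si , refl | j , sj , refl with meet' i j si sj
  ... | y , iy , jy = ψ y , subst₂ _≤_ (sym (ψ-iso i y)) (sym (R-ψ i)) iy
                          , subst₂ _≤_ (sym (ψ-iso j y)) (sym (R-ψ j)) jy
  solution : ∃ λ y → ∀ v → S v ≡ true → dist H v y ≤ R v + 0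
  solution = helly-H S R meet
  x : V H
  x = proj₁ solution
  near : ∀ i → S' i ≡ true → dist H' i (ρ x) ≤ R' i + 0
  near i si = begin
    dist H' i (ρ x)         ≡⟨ cong (λ j → dist H' j (ρ x)) (sym (ρψ i)) ⟩
    dist H' (ρ (ψ i)) (ρ x) ≤⟨ ρ-nonexp (ψ i) x ⟩
    dist H (ψ i) x          ≤⟨ proj₂ solution (ψ i) (image-intro S' ψ i si) ⟩
    R (ψ i) + 0             ≡⟨ cong (_+ 0) (R-ψ i) ⟩
    R' i + 0                ∎
    where open ≤-Reasoning

-- Deleting a dominated vertex.  The graph H, with vertex set Fin (suc N), is given
-- by its components so that its size is visible; z is a vertex and h₁ ≠ z.
module Deletion {N : ℕ} (A : Fin (suc N) → Fin (suc N) → Bool)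
    (A-sym : ∀ u v → A u v ≡ A v u) (A-irr : ∀ u → A u u ≡ false)
    (A-conn : ∀ u v → ∃ λ k → within A k u v ≡ true)
    (z h₁ : Fin (suc N)) (z≢h₁ : z ≢ h₁) where

  H : Graph
  H = record { n = suc N ; adj = A ; adj-sym = A-sym ; adj-irr = A-irr ; connected = A-conn }

  -- If h₁ dominates z, then H − z is a retract of H, hence Helly if H is.
  module Dominated (dominated : ∀ v → v ≢ z → dist H h₁ v ≤ dist H z v) where
    open Metric H

    -- H − z has vertex set Fin N, placed by ψ onto V H ∖ {z}
    ψ : Fin N → Fin (suc N)
    ψ = punchIn z

    A⁻ : Fin N → Fin N → Bool
    A⁻ i j = A (ψ i) (ψ j)

    fold : Fin (suc N) → Fin (suc N)
    fold v with v ≟ z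
    ... | yes _ = h₁
    ... | no _ = v

    fold≢z : ∀ v → z ≢ fold v
    fold≢z v with v ≟ z
    ... | yes _ = z≢h₁
    ... | no v≢z = v≢z ∘ sym

    fold-fix : ∀ v → v ≢ z → fold v ≡ v
    fold-fix v v≢z with v ≟ z
    ... | yes v≡z = ⊥-elim (v≢z v≡z)
    ... | no _ = refl

    -- since h₁ dominates z, an edge at z folds to an edge at h₁ or to the vertex h₁
    fold-weakHom : WeakHom A A fold
    fold-weakHom a b e with a ≟ z | b ≟ z
    ... | yes refl | yes refl = ⊥-elim (true≢false (trans (sym e) (A-irr z)))
      where
      true≢false : true ≢ false
      true≢false ()
    ... | yes refl | no b≢z = dist-one h₁ b (≤-trans (dominated b b≢z) (dist-adj z b e))
    ... | no a≢z | yes refl = dist-one a h₁ (begin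
          dist H a h₁ ≡⟨ dist-sym a h₁ ⟩
          dist H h₁ a ≤⟨ dominated a a≢z ⟩
          dist H z a  ≡⟨ dist-sym z a ⟩
          dist H a z  ≤⟨ dist-adj a z e ⟩
          1           ∎)
      where open ≤-Reasoning
    ... | no _ | no _ = inj₂ e

    ρ : Fin (suc N) → Fin N
    ρ v = punchOut (fold≢z v)

    ψρ : ∀ v → ψ (ρ v) ≡ fold v
    ψρ v = punchIn-punchOut (fold≢z v)

    ρψ : ∀ i → ρ (ψ i) ≡ i
    ρψ i = punchIn-injective z _ _ (trans (ψρ (ψ i)) (fold-fix (ψ i) (punchInᵢ≢i z i)))

    ρ-weakHom : WeakHom A A⁻ ρ
    ρ-weakHom a b e with fold-weakHom a b e
    ... | inj₁ same = inj₁ (punchIn-injective z _ _ (trans (ψρ a) (trans same (sym (ψρ b)))))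
    ... | inj₂ edge = inj₂ (subst₂ (λ x y → A x y ≡ true) (sym (ψρ a)) (sym (ψρ b)) edge)

    H⁻ : Graph
    H⁻ = record { n = N ; adj = A⁻ ; adj-sym = λ i j → A-sym (ψ i) (ψ j) ; adj-irr = A-irr ∘ ψ
                ; connected = connected⁻ }
      where
      connected⁻ : ∀ i j → ∃ λ k → within A⁻ k i j ≡ true
      connected⁻ i j with A-conn (ψ i) (ψ j)
      ... | k , p = k , subst₂ (λ x y → within A⁻ k x y ≡ true) (ρψ i) (ρψ j)
                                (walk-map A A⁻ ρ ρ-weakHom k (ψ i) (ψ j) p)

    ρ-nonexpanding : ∀ a b → dist H⁻ (ρ a) (ρ b) ≤ dist H a b
    ρ-nonexpanding = dist-nonexpanding H H⁻ ρ ρ-weakHom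

    ψ-isometric : IsometricEmbedding H⁻ H ψ
    ψ-isometric i j = ≤-antisym (dist-nonexpanding H⁻ H ψ (λ _ _ e → inj₂ e) i j)
      (subst₂ (λ x y → dist H⁻ x y ≤ dist H (ψ i) (ψ j)) (ρψ i) (ρψ j) (ρ-nonexpanding (ψ i) (ψ j)))

    H⁻-helly : Helly H → Helly H⁻
    H⁻-helly = retract-helly H H⁻ ψ ρ ψ-isometric ρψ ρ-nonexpanding

-- In the injective hull every dominated vertex belongs to the image of G: otherwise
-- deleting it leaves a proper Helly isometric subgraph still containing φ(V G).
dominated-in-image : (G H : Graph) (φ : V G → V H) → IsInjectiveHull G H φ →
  (z h₁ : V H) → z ≢ h₁ → (∀ v → v ≢ z → dist H h₁ v ≤ dist H z v) → (∀ g → φ g ≢ z) → ⊥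
dominated-in-image G H = by-components (n H) (adj H) (adj-sym H) (adj-irr H) (connected H)
  where
  by-components : ∀ N (A : Fin N → Fin N → Bool) (A-sym : ∀ u v → A u v ≡ A v u)
    (A-irr : ∀ u → A u u ≡ false) (A-conn : ∀ u v → ∃ λ k → within A k u v ≡ true) →
    let H = record { n = N ; adj = A ; adj-sym = A-sym ; adj-irr = A-irr ; connected = A-conn } in
    (φ : V G → V H) → IsInjectiveHull G H φ →
    (z h₁ : V H) → z ≢ h₁ → (∀ v → v ≢ z → dist H h₁ v ≤ dist H z v) → (∀ g → φ g ≢ z) → ⊥
  by-components (suc N) A A-sym A-irr A-conn φ hull z h₁ z≢h₁ dominated outside =
    punchInᵢ≢i z (proj₁ z-covered) (proj₂ z-covered)
    where
    open Deletion A A-sym A-irr A-conn z h₁ z≢h₁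
    open Dominated dominated
    open IsInjectiveHull hull
    φ-covered : ∀ g → ∃ λ i → ψ i ≡ φ g
    φ-covered g = ρ (φ g) , trans (ψρ (φ g)) (fold-fix (φ g) (outside g))
    z-covered : ∃ λ i → ψ i ≡ z
    z-covered = minimal H⁻ ψ (H⁻-helly helly) ψ-isometric φ-covered z

-- Every vertex of the hull lies on a geodesic of G.  Fix g₀ ∈ V G and p = φ g₀.
module Geodesics (G H : Graph) (φ : V G → V H) (hull : IsInjectiveHull G H φ) (g₀ : V G) where
  open IsInjectiveHull hull
  open Metric H
  private
    dH : V H → V H → ℕ
    dH = dist H
    dG : V G → V G → ℕ
    dG = dist G

  p : V H
  p = φ g₀

  -- z is detached if it lies on no geodesic from g₀ to a vertex of G
  Detached : V H → Set
  Detached z = ∀ g → dG g₀ g < dH z p + dH z (φ g)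

  detached-outside : ∀ {z} → Detached z → ∀ g → φ g ≢ z
  detached-outside det g refl = <-irrefl refl (subst (dG g₀ g <_) trivial-geodesic (det g))
    where
    trivial-geodesic : dH (φ g) p + dH (φ g) (φ g) ≡ dG g₀ g
    trivial-geodesic = trans (cong₂ _+_ (isometric g g₀) (dist-refl (φ g)))
                        (trans (+-identityʳ (dG g g₀)) (Metric.dist-sym G g g₀))

  -- A detached z that lies on no geodesic from any v ≠ z to p is dominated by the
  -- centre x of the disks D(p, d(z,p) − 1) and D(v, max(d(z,v),1)), v ≠ p.
  module Maximal {z} (det : Detached z) (maximal : ∀ v → v ≢ z → dH v p < dH v z + dH z p) where

    z≢p : z ≢ p
    z≢p z≡p = detached-outside det g₀ (sym z≡p)

    Q : ℕ
    Q = pred (dH z p)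

    zp≡ : dH z p ≡ suc Q
    zp≡ = sym (suc-pred (dH z p) {{>-nonZero (dist-pos z≢p)}})

    radius : ∀ v → Dec (v ≡ p) → ℕ
    radius v (yes _) = Q
    radius v (no _) = dH z v ⊔ 1

    radius-p : ∀ d → radius p d ≡ Q
    radius-p (yes _) = refl
    radius-p (no p≢p) = ⊥-elim (p≢p refl)

    -- by maximality of z (and directly for v = z)
    p-bound : ∀ v → dH v p ≤ Q + (dH z v ⊔ 1)
    p-bound v with v ≟ z
    ... | yes v≡z = subst (λ w → dH w p ≤ Q + (dH z w ⊔ 1)) (sym v≡z)
                      (subst (λ d → dH z p ≤ Q + (d ⊔ 1)) (sym (dist-refl z)) (≤-reflexive (trans zp≡ (+-comm 1 Q))))
    ... | no v≢z = begin
      dH v p           ≤⟨ ≤-pred (subst (dH v p <_) (trans (cong (dH v z +_) zp≡) (+-suc (dH v z) Q)) (maximal v v≢z)) ⟩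
      dH v z + Q       ≡⟨ trans (+-comm (dH v z) Q) (cong (Q +_) (dist-sym v z)) ⟩
      Q + dH z v       ≤⟨ +-monoʳ-≤ Q (m≤m⊔n (dH z v) 1) ⟩
      Q + (dH z v ⊔ 1) ∎
      where open ≤-Reasoning

    z-bound : ∀ u v → dH u v ≤ (dH z u ⊔ 1) + (dH z v ⊔ 1)
    z-bound u v = ≤-trans (dist-triangle u z v)
                          (+-mono-≤ (≤-trans (≤-reflexive (dist-sym u z)) (m≤m⊔n (dH z u) 1)) (m≤m⊔n (dH z v) 1))

    radii-cover : ∀ u v (du : Dec (u ≡ p)) (dv : Dec (v ≡ p)) → dH u v ≤ radius u du + radius v dv
    radii-cover u v (yes refl) (yes refl) = subst (_≤ Q + Q) (sym (dist-refl p)) z≤n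
    radii-cover u v (yes refl) (no _) = subst (_≤ Q + (dH z v ⊔ 1)) (dist-sym v p) (p-bound v)
    radii-cover u v (no _) (yes refl) = ≤-trans (p-bound u) (≤-reflexive (+-comm Q (dH z u ⊔ 1)))
    radii-cover u v (no _) (no _) = z-bound u v

    centre : ∃ λ y → ∀ v → true ≡ true → dH v y ≤ radius v (v ≟ p)
    centre = helly-dist H helly (λ _ → true) (λ v → radius v (v ≟ p))
                        (λ u v _ _ → radii-cover u v (u ≟ p) (v ≟ p))

    x : V H
    x = proj₁ centre

    x-near : ∀ v → dH v x ≤ radius v (v ≟ p)
    x-near v = proj₂ centre v refl

    z≢x : z ≢ x
    z≢x z≡x = 1+n≰n (begin
      suc Q   ≡⟨ sym zp≡ ⟩
      dH z p  ≡⟨ cong₂ dH z≡x refl ⟩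
      dH x p  ≡⟨ dist-sym x p ⟩
      dH p x  ≤⟨ x-near p ⟩
      radius p (p ≟ p) ≡⟨ radius-p (p ≟ p) ⟩
      Q       ∎)
      where open ≤-Reasoning

    radius-≤ : ∀ v → v ≢ z → (d : Dec (v ≡ p)) → radius v d ≤ dH z v
    radius-≤ v v≢z (yes refl) = ≤-trans (n≤1+n Q) (≤-reflexive (sym zp≡))
    radius-≤ v v≢z (no _) = ≤-reflexive (m≥n⇒m⊔n≡m (dist-pos (v≢z ∘ sym)))

    x-dominates : ∀ v → v ≢ z → dH x v ≤ dH z v
    x-dominates v v≢z = subst (_≤ dH z v) (dist-sym v x) (≤-trans (x-near v) (radius-≤ v v≢z (v ≟ p)))

    impossible : ⊥
    impossible = dominated-in-image G H φ hull z x z≢x x-dominates (detached-outside det)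

  -- No vertex is detached: from a detached z that is not maximal we move to a
  -- detached v strictly farther from p, which can happen fewer than n times.
  no-detached : ∀ k z → Detached z → n H ≤ dH z p + k → ⊥
  no-detached k z det bound with any? (λ v → ¬? (v ≟ z) ×-dec (dH v z + dH z p ≤? dH v p))
  ... | no none = Maximal.impossible det (λ v v≢z → ≰⇒> (λ le → none (v , v≢z , le)))
  ... | yes (v , v≢z , z-between) = step k bound
    where
    v-detached : Detached v
    v-detached g = begin-strict
      dG g₀ g                        <⟨ det g ⟩
      dH z p + dH z (φ g)            ≤⟨ +-monoʳ-≤ (dH z p) (dist-triangle z v (φ g)) ⟩
      dH z p + (dH z v + dH v (φ g)) ≡⟨ sym (+-assoc (dH z p) (dH z v) (dH v (φ g))) ⟩
      dH z p + dH z v + dH v (φ g)   ≡⟨ cong (_+ dH v (φ g)) (trans (+-comm (dH z p) (dH z v)) (cong (_+ dH z p) (dist-sym z v))) ⟩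
      dH v z + dH z p + dH v (φ g)   ≤⟨ +-monoˡ-≤ (dH v (φ g)) z-between ⟩
      dH v p + dH v (φ g)            ∎
      where open ≤-Reasoning
    farther : dH z p < dH v p
    farther = ≤-trans (+-monoˡ-≤ (dH z p) (dist-pos v≢z)) z-between
    step : ∀ j → n H ≤ dH z p + j → ⊥
    step zero bound = <-irrefl refl (≤-trans (s≤s (subst (n H ≤_) (+-identityʳ (dH z p)) bound))
                                             (≤-trans farther (dist-bounded v p)))
    step (suc j) bound = no-detached j v v-detached
                           (≤-trans bound (≤-trans (≤-reflexive (+-suc (dH z p) j)) (+-monoˡ-≤ j farther)))

  on-geodesic : ∀ h → ∃ λ g → dH h p + dH h (φ g) ≤ dG g₀ g
  on-geodesic h with any? (λ g → dH h p + dH h (φ g) ≤? dG g₀ g)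
  ... | yes found = found
  ... | no none = ⊥-elim (no-detached (n H) h (λ g → ≰⇒> (λ le → none (g , le))) (m≤n+m (n H) _))

-- The disks
-- D(g, d(h,φ g)), g ∈ V G, pairwise meet, so some x ∈ V G has d(g,x) ≤ d(h,φ g) + α
-- for all g; choosing g with h on a geodesic from x to g gives d(h,φ x) ≤ α.
close-to-image : (α : ℕ) (G H : Graph) (φ : V G → V H) → WeaklyHelly α G → IsInjectiveHull G H φ →
  ∀ h → ∃ λ g → dist H h (φ g) ≤ α
close-to-image α G H φ wh hull h = x , +-cancelʳ-≤ (r g) (r x) α x-close
  where
  open IsInjectiveHull hull
  r : V G → ℕ
  r g = dist H h (φ g)
  radii-cover : ∀ u v → true ≡ true → true ≡ true → dist G u v ≤ r u + r v
  radii-cover u v _ _ = subst (_≤ r u + r v) (isometric u v)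
    (≤-trans (Metric.dist-triangle H (φ u) h (φ v)) (+-monoˡ-≤ (r v) (≤-reflexive (Metric.dist-sym H (φ u) h))))
  centre : ∃ λ y → ∀ g → true ≡ true → dist G g y ≤ r g + α
  centre = weaklyHelly-dist G wh (λ _ → true) r radii-cover
  x : V G
  x = proj₁ centre
  g : V G
  g = proj₁ (Geodesics.on-geodesic G H φ hull x h)
  x-close : r x + r g ≤ α + r g
  x-close = begin
    r x + r g  ≤⟨ proj₂ (Geodesics.on-geodesic G H φ hull x h) ⟩
    dist G x g ≡⟨ Metric.dist-sym G x g ⟩
    dist G g x ≤⟨ proj₂ centre g refl ⟩
    r g + α    ≡⟨ +-comm (r g) α ⟩
    α + r g    ∎
    where open ≤-Reasoning

module Centres (G X : Graph) (f : V G → V X) (M : V G → Bool) where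
  private
    e : V X → ℕ
    e = ecc G X f M
    r : ℕ
    r = rad G X f M

  ecc-≥ : ∀ v m → M m ≡ true → dist X v (f m) ≤ e v
  ecc-≥ v m Mm = subst (_≤ e v) (cong (λ b → if b then dist X v (f m) else 0) Mm)
                   (maxF-ub (λ u → if M u then dist X v (f u) else 0) m)

  ecc-≤ : ∀ v K → (∀ m → M m ≡ true → dist X v (f m) ≤ K) → e v ≤ K
  ecc-≤ v K bound = maxF-lub _ K term
    where
    term : ∀ m → (if M m then dist X v (f m) else 0) ≤ K
    term m with M m in Mm
    ... | true = bound m Mm
    ... | false = z≤n

  rad-≤ : ∀ v → r ≤ e v
  rad-≤ = minF-lb e

  rad-attained : V X → ∃ λ c → r ≡ e c
  rad-attained = minF-attained e

  centre-near : ∀ c → r ≡ e c → ∀ m → M m ≡ true → dist X c (f m) ≤ r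
  centre-near c r≡ m Mm = subst (dist X c (f m) ≤_) (sym r≡) (ecc-≥ c m Mm)

  ecc-lipschitz : ∀ a b → e a ≤ dist X a b + e b
  ecc-lipschitz a b = ecc-≤ a _ λ m Mm →
    ≤-trans (Metric.dist-triangle X a b (f m)) (+-monoʳ-≤ (dist X a b) (ecc-≥ b m Mm))

  centre-intro : ∀ ℓ v → e v ≤ r + ℓ → center G X f M ℓ v ≡ true
  centre-intro ℓ v le = Equivalence.to T-≡ (≤⇒≤ᵇ le)

  centre-elim : ∀ ℓ v → center G X f M ℓ v ≡ true → e v ≤ r + ℓ
  centre-elim ℓ v c = ≤ᵇ⇒≤ (e v) (r + ℓ) (Equivalence.from T-≡ c)

ecc-isometric : (G H : Graph) (φ : V G → V H) → IsometricEmbedding G H φ →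
  ∀ M g → ecc G H φ M (φ g) ≡ ecc G G id M g
ecc-isometric G H φ iso M g = maxF-cong _ _ λ u → cong (λ d → if M u then d else 0) (iso g u)

diam-≥ : ∀ (X : Graph) S u v → S u ≡ true → S v ≡ true → dist X u v ≤ diam X S
diam-≥ X S u v su sv =
  ≤-trans (subst (_≤ _) (cong (λ b → if b then dist X u v else 0) (∧-intro su sv))
                 (maxF-ub (λ w → if S u ∧ S w then dist X u w else 0) v))
          (maxF-ub (λ w → maxF (λ y → if S w ∧ S y then dist X w y else 0)) u)

diam-≤ : ∀ (X : Graph) S K → (∀ u v → S u ≡ true → S v ≡ true → dist X u v ≤ K) → diam X S ≤ K
diam-≤ X S K bound = maxF-lub _ K λ u → maxF-lub _ K λ v → term u v
  where
  term : ∀ u v → (if S u ∧ S v then dist X u v else 0) ≤ K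
  term u v with S u ∧ S v in Suv
  ... | true = bound u v (proj₁ (∧-elim {S u} Suv)) (proj₂ (∧-elim {S u} Suv))
  ... | false = z≤n

diam-near : (X Y Z : Graph) (ι : V X → V Z) (κ : V Y → V Z) →
  IsometricEmbedding X Z ι → IsometricEmbedding Y Z κ →
  (S : V X → Bool) (S' : V Y → Bool) (c : ℕ) →
  (∀ u → S u ≡ true → ∃ λ u' → S' u' ≡ true × dist Z (ι u) (κ u') ≤ c) →
  diam X S ≤ diam Y S' + 2 * c
diam-near X Y Z ι κ ι-iso κ-iso S S' c near =
  diam-≤ X S _ λ u v su sv → bound (near u su) (near v sv)
  where
  bound : ∀ {u v} → (∃ λ u' → S' u' ≡ true × dist Z (ι u) (κ u') ≤ c) →
                    (∃ λ v' → S' v' ≡ true × dist Z (ι v) (κ v') ≤ c) → dist X u v ≤ diam Y S' + 2 * c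
  bound {u} {v} (u' , su' , uu') (v' , sv' , vv') = begin
    dist X u v                    ≡⟨ sym (ι-iso u v) ⟩
    dist Z (ι u) (ι v)            ≤⟨ Metric.dist-detour Z uu' vv' ⟩
    dist Z (κ u') (κ v') + 2 * c  ≡⟨ cong (_+ 2 * c) (κ-iso u' v') ⟩
    dist Y u' v' + 2 * c          ≤⟨ +-monoˡ-≤ (2 * c) (diam-≥ Y S' u' v' su' sv') ⟩
    diam Y S' + 2 * c             ∎
    where open ≤-Reasoning

module Comparison (α : ℕ) (G H : Graph) (φ : V G → V H)
    (wh : WeaklyHelly α G) (hull : IsInjectiveHull G H φ) (M : V G → Bool) where
  open IsInjectiveHull hull
  open Metric H
  module CG = Centres G G id M
  module CH = Centres G H φ M
  private
    eG : V G → ℕ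
    eG = ecc G G id M
    eH : V H → ℕ
    eH = ecc G H φ M
    rG rH : ℕ
    rG = rad G G id M
    rH = rad G H φ M

  ecc-φ : ∀ g → eH (φ g) ≡ eG g
  ecc-φ = ecc-isometric G H φ isometric M

  rH≤rG : V G → rH ≤ rG
  rH≤rG g = via (CG.rad-attained g)
    where
    via : (∃ λ c → rG ≡ eG c) → rH ≤ rG
    via (c , rG≡) = ≤-trans (CH.rad-≤ (φ c)) (≤-reflexive (trans (ecc-φ c) (sym rG≡)))

  ecc-near : ∀ h g → dist H h (φ g) ≤ α → eG g ≤ α + eH h
  ecc-near h g hg≤α = begin
    eG g                  ≡⟨ sym (ecc-φ g) ⟩
    eH (φ g)              ≤⟨ CH.ecc-lipschitz (φ g) h ⟩
    dist H (φ g) h + eH h ≤⟨ +-monoˡ-≤ (eH h) (subst (_≤ α) (dist-sym h (φ g)) hg≤α) ⟩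
    α + eH h              ∎
    where open ≤-Reasoning

  rG≤α+rH : V H → rG ≤ α + rH
  rG≤α+rH h = via (CH.rad-attained h)
    where
    via : (∃ λ c → rH ≡ eH c) → rG ≤ α + rH
    via (c , rH≡) = via-g (close-to-image α G H φ wh hull c)
      where
      via-g : (∃ λ g → dist H c (φ g) ≤ α) → rG ≤ α + rH
      via-g (g , cg≤α) = ≤-trans (CG.rad-≤ g) (subst (λ r → eG g ≤ α + r) (sym rH≡) (ecc-near c g cg≤α))

  rG≤2rH : ∀ m → M m ≡ true → rG ≤ rH + rH
  rG≤2rH m Mm = via (CH.rad-attained (φ m))
    where
    via : (∃ λ c → rH ≡ eH c) → rG ≤ rH + rH
    via (c , rH≡) = begin
      rG                    ≤⟨ CG.rad-≤ m ⟩
      eG m                  ≡⟨ sym (ecc-φ m) ⟩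
      eH (φ m)              ≤⟨ CH.ecc-lipschitz (φ m) c ⟩
      dist H (φ m) c + eH c ≤⟨ +-mono-≤ (subst (_≤ rH) (dist-sym c (φ m)) (CH.centre-near c rH≡ m Mm))
                                        (≤-reflexive (sym rH≡)) ⟩
      rH + rH               ∎
      where open ≤-Reasoning

  H-centre-near : ∀ ℓ u → center G H φ M ℓ u ≡ true →
                  ∃ λ g → center G G id M (α + ℓ) g ≡ true × dist H u (φ g) ≤ α
  H-centre-near ℓ u cu = via (close-to-image α G H φ wh hull u)
    where
    via : (∃ λ g → dist H u (φ g) ≤ α) → ∃ λ g → center G G id M (α + ℓ) g ≡ true × dist H u (φ g) ≤ α
    via (g , ug≤α) = g , CG.centre-intro (α + ℓ) g eg-bound , ug≤α
      where
      open ≤-Reasoning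
      eg-bound : eG g ≤ rG + (α + ℓ)
      eg-bound = begin
        eG g          ≤⟨ ecc-near u g ug≤α ⟩
        α + eH u      ≤⟨ +-monoʳ-≤ α (CH.centre-elim ℓ u cu) ⟩
        α + (rH + ℓ)  ≤⟨ +-monoʳ-≤ α (+-monoˡ-≤ ℓ (rH≤rG g)) ⟩
        α + (rG + ℓ)  ≡⟨ trans (sym (+-assoc α rG ℓ)) (trans (cong (_+ ℓ) (+-comm α rG)) (+-assoc rG α ℓ)) ⟩
        rG + (α + ℓ)  ∎

  -- each vertex x of C_G^ℓ(M) is within α of a vertex of C_H^ℓ(M): with K = rad_H + ℓ,
  -- apply the Helly property of H to D(φ x, min(α,K)) and D(φ m, K), m ∈ M
  G-centre-near : ∀ ℓ x → center G G id M ℓ x ≡ true →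
                  ∃ λ x' → center G H φ M ℓ x' ≡ true × dist H (φ x) x' ≤ α
  G-centre-near ℓ x cx = x' , CH.centre-intro ℓ x' (CH.ecc-≤ x' K M-near) , ≤-trans t-near (m⊓n≤m α K)
    where
    open ≤-Reasoning
    K : ℕ
    K = rH + ℓ
    t : V H
    t = φ x
    c : V H
    c = proj₁ (CH.rad-attained t)
    c-central : ∀ m → M m ≡ true → dist H c (φ m) ≤ rH
    c-central = CH.centre-near c (proj₂ (CH.rad-attained t))

    M-close : ∀ m → M m ≡ true → ∀ m' → M m' ≡ true → dist H (φ m) (φ m') ≤ K + K
    M-close m Mm m' Mm' = begin
      dist H (φ m) (φ m')              ≤⟨ dist-triangle (φ m) c (φ m') ⟩
      dist H (φ m) c + dist H c (φ m') ≤⟨ +-mono-≤ (subst (_≤ rH) (dist-sym c (φ m)) (c-central m Mm))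
                                                   (c-central m' Mm') ⟩
      rH + rH                          ≤⟨ +-mono-≤ (m≤m+n rH ℓ) (m≤m+n rH ℓ) ⟩
      K + K                            ∎

    x-ecc : ∀ m → M m ≡ true → eG x ≤ (α ⊓ K) + K
    x-ecc m Mm = subst (eG x ≤_) (sym (+-distribʳ-⊓ K α K)) (⊓-glb via-α via-M)
      where
      x-central : eG x ≤ rG + ℓ
      x-central = CG.centre-elim ℓ x cx
      via-α : eG x ≤ α + K
      via-α = ≤-trans x-central (≤-trans (+-monoˡ-≤ ℓ (rG≤α+rH t)) (≤-reflexive (+-assoc α rH ℓ)))
      via-M : eG x ≤ K + K
      via-M = begin
        eG x          ≤⟨ x-central ⟩
        rG + ℓ        ≤⟨ +-monoˡ-≤ ℓ (rG≤2rH m Mm) ⟩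
        rH + rH + ℓ   ≡⟨ +-assoc rH rH ℓ ⟩
        rH + K        ≤⟨ +-monoˡ-≤ K (m≤m+n rH ℓ) ⟩
        K + K         ∎

    t-close : ∀ m → M m ≡ true → dist H t (φ m) ≤ (α ⊓ K) + K
    t-close m Mm = ≤-trans (CH.ecc-≥ t m Mm) (subst (_≤ (α ⊓ K) + K) (sym (ecc-φ x)) (x-ecc m Mm))

    anchor : ∃ λ y → dist H t y ≤ α ⊓ K × ∀ v → image M φ v ≡ true → dist H v y ≤ K
    anchor = helly-anchor H helly (image M φ) t (α ⊓ K) K (m⊓n≤n α K)
      (image-all M φ (λ v → dist H t v ≤ (α ⊓ K) + K) t-close)
      (λ u v Tu Tv → image-all M φ (λ u → dist H u v ≤ K + K)
         (λ m Mm → image-all M φ (λ v → dist H (φ m) v ≤ K + K) (M-close m Mm) v Tv) u Tu)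
    x' : V H
    x' = proj₁ anchor
    t-near : dist H t x' ≤ α ⊓ K
    t-near = proj₁ (proj₂ anchor)
    M-near : ∀ m → M m ≡ true → dist H x' (φ m) ≤ K
    M-near m Mm = subst (_≤ K) (dist-sym (φ m) x') (proj₂ (proj₂ anchor) (φ m) (image-intro M φ m Mm))

theorem2 : (α : ℕ) (G H : Graph) (φ : V G → V H) →
    WeaklyHelly α G → IsInjectiveHull G H φ →
    (ℓ : ℕ) (M : V G → Bool) →
    (diam G (center G G id M ℓ) ≤ diam H (center G H φ M ℓ) + 2 * α)
    × (diam H (center G H φ M ℓ) ≤ diam G (center G G id M (α + ℓ)) + 2 * α)
theorem2 α G H φ wh hull ℓ M =
    diam-near G H H φ id isometric (λ _ _ → refl) CG CH α (G-centre-near ℓ)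
  , diam-near H G H id φ (λ _ _ → refl) isometric CH CG⁺ α (H-centre-near ℓ)
  where
  open Comparison α G H φ wh hull M
  open IsInjectiveHull hull using (isometric)
  CG CG⁺ : V G → Bool
  CG = center G G id M ℓ
  CG⁺ = center G G id M (α + ℓ)
  CH : V H → Bool
  CH = center G H φ M ℓ
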